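{- For $v > 9$, the localization number of the incidence graph of any Steiner triple system $\mathrm{STS}(v)$ is strictly larger than $\lfloor \frac{v-2}{8} \rfloor$.
   Context: A Steiner triple system $\mathrm{STS}(v)$ ($v \ge 7$) is a set $X$ of $v$ points with a collection of $3$-element subsets (blocks) such that every pair of distinct points lies in exactly one block; equivalently a $\mathrm{BIBD}(v, v(v-1)/6, (v-1)/2, 3, 1)$. Its incidence graph is the bipartite graph on points and blocks with $x \sim B$ iff $x \in B$. Localization game on a connected graph $G$ with $k$ cops: the robber chooses a starting vertex, invisible to the cops. Each round the cops choose any $k$ vertices (no adjacency restriction) and each learns its distance to the robber; the cops win if after finitely many rounds they determine the robber's vertex uniquely; otherwise the robber moves to a neighbour or stays. The robber knows the cops' strategy. The localization number $\zeta(G)$ is the least $k$ for which $k$ cops can guarantee capture. -}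

module Defs where

open import Data.Nat using (ℕ; zero; suc; _<_; _≤_)
open import Data.Fin using (Fin)
open import Data.Fin.Subset using (Subset; _∈_; ∣_∣)
open import Data.List using (List; map; upTo)
open import Data.Sum using (_⊎_; inj₁; inj₂)
open import Data.Product using (Σ; _×_; ∃)
open import Data.Empty using (⊥)
open import Relation.Nullary using (¬_)
open import Relation.Binary.PropositionalEquality using (_≡_; _≢_)

record STS (v : ℕ) : Set where
  field
    b          : ℕ
    block      : Fin b → Subset v
    block-size : ∀ B → ∣ block B ∣ ≡ 3
    pair-ex    : ∀ x y → x ≢ y → Σ (Fin b) λ B → x ∈ block B × y ∈ block B
    pair-uniq  : ∀ x y → x ≢ y → ∀ B B' →
                 x ∈ block B → y ∈ block B →
                 x ∈ block B' → y ∈ block B' → B ≡ B'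

open STS public

IncV : ∀ {v} → STS v → Set
IncV {v} S = Fin v ⊎ Fin (b S)

IncE : ∀ {v} (S : STS v) → IncV S → IncV S → Set
IncE S (inj₁ x) (inj₂ B) = x ∈ block S B
IncE S (inj₂ B) (inj₁ x) = x ∈ block S B
IncE S (inj₁ _) (inj₁ _) = ⊥
IncE S (inj₂ _) (inj₂ _) = ⊥

data Walk {V : Set} (E : V → V → Set) : V → V → ℕ → Set where
  here : ∀ {u} → Walk E u u zero
  step : ∀ {u x w d} → E u x → Walk E x w d → Walk E u w (suc d)

IsDist : {V : Set} (E : V → V → Set) → V → V → ℕ → Set
IsDist E u w d = Walk E u w d × (∀ d' → d' < d → ¬ Walk E u w d')

-- A cop strategy picks the k probed vertices of the next round from the
-- list of distance vectors observed in the previous rounds (the strategy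
-- is deterministic; the robber knows it).

Strategy : (V : Set) → ℕ → Set
Strategy V k = List (Fin k → ℕ) → (Fin k → V)

RobberWalk : {V : Set} (E : V → V → Set) → (ℕ → V) → Set
RobberWalk E w = ∀ i → w (suc i) ≡ w i ⊎ E (w i) (w (suc i))

history : ∀ {k} → (ℕ → (Fin k → ℕ)) → ℕ → List (Fin k → ℕ)
history rs i = map rs (upTo i)

AnswersUpTo : {V : Set} (E : V → V → Set) {k : ℕ} → Strategy V k →
              (ℕ → V) → (ℕ → (Fin k → ℕ)) → ℕ → Set
AnswersUpTo E σ w rs t =
  ∀ i → i ≤ t → ∀ j → IsDist E (σ (history rs i) j) (w i) (rs i j)

Wins : {V : Set} (E : V → V → Set) {k : ℕ} → Strategy V k → Set
Wins E σ =
  ∀ w → RobberWalk E w → ∀ rs → (∀ t → AnswersUpTo E σ w rs t) →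
  ∃ λ t → ∀ w' → RobberWalk E w' → AnswersUpTo E σ w' rs t → w' t ≡ w t

CopsWin : {V : Set} (E : V → V → Set) → ℕ → Set
CopsWin {V} E k = Σ (Strategy V k) λ σ → Wins E σ

LocNumberGreaterThan : {V : Set} (E : V → V → Set) → ℕ → Set
LocNumberGreaterThan E m = ∀ k → k ≤ m → ¬ CopsWin E k

-- The robber alternates between points and lines.  From a point x it moves to a line
-- through x; for k probes, every line through x and a point outside a set of at most
-- 6k + 1 exceptional points lies at a predictable ("typical") distance from each probe,
-- so the cops learn nothing about which such line the robber chose, and there are always
-- at least two of them.  It then moves to a point of its line.  The at least 2k + 2
-- points covered by typical lines cannot all be separated by the next k probes: a probe
-- only sees whether a point is among its at most three near points, and a weight count
-- shows that at most 2k + 1 points can have pairwise different signatures.  So some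
-- s₁ ≠ s₂ give identical answers; the robber goes to s₁ but could have gone to s₂.  At
-- every round two positions remain consistent with the answers, as long as 8k + 2 ≤ v.
module Submission where

open import Defs
open import Data.Nat using (ℕ; zero; suc; _+_; _*_; _∸_; _≤_; _<_; z≤n; s≤s)
open import Data.Nat.Properties
import Data.Nat as ℕ
open import Data.Nat.DivMod using (_/_; m/n*n≤m)
open import Data.Nat.ListAction using (sum)
open import Data.Nat.Tactic.RingSolver using (solve-∀)
open import Data.Bool using (Bool; true; false; if_then_else_)
import Data.Bool.Properties as Bool
open import Data.Fin using (Fin; zero; suc)
import Data.Fin.Properties as Fin
open import Data.Fin.Subset using (Subset; ∣_∣) renaming (_∈_ to _∈ˢ_)
open import Data.Vec using ([]; _∷_; here; there)
open import Data.List using (List; []; _∷_; length; map; filter; _++_; concatMap; allFin; upTo; _∷ʳ_)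
open import Data.List.Properties using (length-map; length-++; length-tabulate; filter-notAll)
open import Data.List.Membership.Propositional using (_∈_; _∉_; find)
open import Data.List.Membership.Propositional.Properties
  using (∈-map⁺; ∈-map⁻; ∈-filter⁺; ∈-filter⁻; ∈-concat⁺′; ∈-++⁺ˡ; ∈-++⁺ʳ; ∈-allFin)
open import Data.List.Relation.Unary.Any using (here; there; any?)
open import Data.List.Relation.Unary.All using (All; []; _∷_; all?)
import Data.List.Relation.Unary.All as All
open import Data.List.Relation.Unary.All.Properties using (¬Any⇒All¬; ¬All⇒Any¬)
open import Data.List.Relation.Unary.AllPairs using (AllPairs; []; _∷_)
import Data.List.Relation.Unary.AllPairs.Properties as AllPairs
open import Data.List.Relation.Unary.Unique.Propositional using (Unique)
import Data.List.Relation.Unary.Unique.Propositional.Properties as Unique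
open import Data.List.Relation.Binary.Subset.Propositional using (_⊆_)
open import Data.Product using (Σ; ∃; _×_; _,_; proj₁; proj₂)
open import Data.Sum using (_⊎_; inj₁; inj₂)
open import Data.Sum.Properties using (inj₁-injective; inj₂-injective)
open import Function using (_∘_)
open import Relation.Nullary using (¬_; Dec; yes; no; does; ¬?)
open import Relation.Nullary.Negation using (contradiction)
open import Relation.Nullary.Decidable using (dec-true; dec-false)
open import Relation.Binary.Definitions using (DecidableEquality)
open import Relation.Binary.PropositionalEquality
  using (_≡_; _≢_; refl; sym; trans; cong; cong₂; subst; module ≡-Reasoning)
open import Algebra.Properties.CommutativeMonoid.Sum +-0-commutativeMonoid
  using (∑-distrib-+; sum-cong-≗) renaming (sum to ∑)

module _ {A : Set} (_≟_ : DecidableEquality A) where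

  remove : A → List A → List A
  remove x = filter (λ y → ¬? (y ≟ x))

  length-remove< : ∀ {x ys} → x ∈ ys → length (remove x ys) < length ys
  length-remove< {x} {ys} x∈ys = filter-notAll (λ y → ¬? (y ≟ x)) ys (Any.map (λ x≡y y≢x → y≢x (sym x≡y)) x∈ys)
    where import Data.List.Relation.Unary.Any as Any

  ∈-remove⁺ : ∀ {x y ys} → y ∈ ys → y ≢ x → y ∈ remove x ys
  ∈-remove⁺ {x} = ∈-filter⁺ (λ y → ¬? (y ≟ x))

  unique-⊆⇒length≤ : ∀ {xs ys} → Unique xs → xs ⊆ ys → length xs ≤ length ys
  unique-⊆⇒length≤ {[]} _ _ = z≤n
  unique-⊆⇒length≤ {x ∷ xs} {ys} (x∉xs ∷ xs!) xs⊆ys =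
    ≤-trans (s≤s (unique-⊆⇒length≤ xs! xs⊆ys-x)) (length-remove< (xs⊆ys (here refl)))
    where
    xs⊆ys-x : xs ⊆ remove x ys
    xs⊆ys-x z∈xs = ∈-remove⁺ (xs⊆ys (there z∈xs)) (λ z≡x → All.lookup x∉xs z∈xs (sym z≡x))

length-concatMap≤ : ∀ {A B : Set} {f : A → List B} {c} → (∀ a → length (f a) ≤ c) →
  ∀ xs → length (concatMap f xs) ≤ length xs * c
length-concatMap≤         f≤c []       = z≤n
length-concatMap≤ {f = f} f≤c (a ∷ xs) =
  ≤-trans (≤-reflexive (length-++ (f a))) (+-mono-≤ (f≤c a) (length-concatMap≤ f≤c xs))

∈-concatMap⁺ : ∀ {A B : Set} {f : A → List B} {a xs y} → a ∈ xs → y ∈ f a → y ∈ concatMap f xs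
∈-concatMap⁺ {f = f} a∈xs y∈fa = ∈-concat⁺′ y∈fa (∈-map⁺ f a∈xs)

nonempty⇒∈ : ∀ {A : Set} (xs : List A) → 0 < length xs → ∃ (_∈ xs)
nonempty⇒∈ (x ∷ _) _ = x , here refl

length-filter-∷ : ∀ {A : Set} {P : A → Set} (P? : ∀ a → Dec (P a)) a L →
  length (filter P? (a ∷ L)) ≡ (if does (P? a) then 1 else 0) + length (filter P? L)
length-filter-∷ P? a L with does (P? a)
... | true  = refl
... | false = refl

ifᵈ-yes : ∀ {P : Set} (P? : Dec P) {a c : ℕ} → P → (if does P? then a else c) ≡ a
ifᵈ-yes P? p rewrite dec-true P? p = refl

ifᵈ-no : ∀ {P : Set} (P? : Dec P) {a c : ℕ} → ¬ P → (if does P? then a else c) ≡ c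
ifᵈ-no P? ¬p rewrite dec-false P? ¬p = refl

elements : ∀ {n} → Subset n → List (Fin n)
elements []          = []
elements (true ∷ p)  = zero ∷ map suc (elements p)
elements (false ∷ p) = map suc (elements p)

length-elements : ∀ {n} (p : Subset n) → length (elements p) ≡ ∣ p ∣
length-elements []          = refl
length-elements (true ∷ p)  = cong suc (trans (length-map suc (elements p)) (length-elements p))
length-elements (false ∷ p) = trans (length-map suc (elements p)) (length-elements p)

∈-elements⁺ : ∀ {n} {p : Subset n} {x} → x ∈ˢ p → x ∈ elements p
∈-elements⁺ {p = true ∷ p}  here       = here refl
∈-elements⁺ {p = true ∷ p}  (there x∈) = there (∈-map⁺ suc (∈-elements⁺ x∈))
∈-elements⁺ {p = false ∷ p} (there x∈) = ∈-map⁺ suc (∈-elements⁺ x∈)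

∈-elements⁻ : ∀ {n} {p : Subset n} {x} → x ∈ elements p → x ∈ˢ p
∈-elements⁻ {p = true ∷ p} (here refl) = here
∈-elements⁻ {p = true ∷ p} (there x∈) with ∈-map⁻ suc x∈
... | _ , y∈ , refl = there (∈-elements⁻ y∈)
∈-elements⁻ {p = false ∷ p} x∈ with ∈-map⁻ suc x∈
... | _ , y∈ , refl = there (∈-elements⁻ y∈)

record Twins {A : Set} (R : A → A → Set) (L : List A) : Set where
  field
    {fst snd} : A
    fst∈      : fst ∈ L
    snd∈      : snd ∈ L
    distinct  : fst ≢ snd
    related   : R fst snd

Twins-map : ∀ {A : Set} {R R′ : A → A → Set} {L} → (∀ {a b} → R a b → R′ a b) → Twins R L → Twins R′ L
Twins-map R⇒R′ t = record { fst∈ = fst∈ ; snd∈ = snd∈ ; distinct = distinct ; related = R⇒R′ related }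
  where open Twins t

AllPairs⇒length≤1 : ∀ {A : Set} {R : A → A → Set} {L : List A} → AllPairs R L →
  (∀ {a b} → a ∈ L → b ∈ L → ¬ R a b) → length L ≤ 1
AllPairs⇒length≤1 {L = []}        _                 _   = z≤n
AllPairs⇒length≤1 {L = a ∷ []}    _                 _   = s≤s z≤n
AllPairs⇒length≤1 {L = a ∷ b ∷ L} ((Rab ∷ _) ∷ _) ¬R = contradiction Rab (¬R (here refl) (there (here refl)))

∑≡0⇒≡0 : ∀ {k} (f : Fin k → ℕ) → ∑ f ≡ 0 → ∀ j → f j ≡ 0
∑≡0⇒≡0 {suc k} f ∑f≡0 zero    = m+n≡0⇒m≡0 (f zero) ∑f≡0
∑≡0⇒≡0 {suc k} f ∑f≡0 (suc j) = ∑≡0⇒≡0 (f ∘ suc) (m+n≡0⇒n≡0 (f zero) ∑f≡0) j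

∑-≤-single : ∀ {k} (f : Fin k → ℕ) j → f j ≤ ∑ f
∑-≤-single {suc k} f zero    = m≤m+n (f zero) _
∑-≤-single {suc k} f (suc j) = ≤-trans (∑-≤-single (f ∘ suc) j) (m≤n+m _ (f zero))

∑-≤-pair : ∀ {k} (f : Fin k → ℕ) {i j} → i ≢ j → f i + f j ≤ ∑ f
∑-≤-pair {suc k} f {zero}  {zero}  i≢j = contradiction refl i≢j
∑-≤-pair {suc k} f {zero}  {suc j} _   = +-monoʳ-≤ (f zero) (∑-≤-single (f ∘ suc) j)
∑-≤-pair {suc k} f {suc i} {zero}  _   =
  ≤-trans (≤-reflexive (+-comm (f (suc i)) (f zero))) (+-monoʳ-≤ (f zero) (∑-≤-single (f ∘ suc) i))
∑-≤-pair {suc k} f {suc i} {suc j} i≢j =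
  ≤-trans (∑-≤-pair (f ∘ suc) (i≢j ∘ cong suc)) (m≤n+m _ (f zero))

∑-≤-const : ∀ {k} (f : Fin k → ℕ) {c} → (∀ j → f j ≤ c) → ∑ f ≤ k * c
∑-≤-const {zero}  f f≤c = z≤n
∑-≤-const {suc k} f f≤c = +-mono-≤ (f≤c zero) (∑-≤-const (f ∘ suc) (f≤c ∘ suc))

module Signatures {A : Set} (_≟_ : DecidableEquality A) {k : ℕ} (tests : Fin k → List A) where

  open import Data.List.Membership.DecPropositional _≟_ using (_∈?_)

  signature : A → Fin k → Bool
  signature a j = does (a ∈? tests j)

  SameSignature : A → A → Set
  SameSignature a b = ∀ j → signature a j ≡ signature b j

  sameSignature? : ∀ a b → Dec (SameSignature a b)
  sameSignature? a b = Fin.all? λ j → signature a j Bool.≟ signature b j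

  sameSignature⇒∈ : ∀ {a b} → SameSignature a b → ∀ j → a ∈ tests j → b ∈ tests j
  sameSignature⇒∈ {a} {b} same j a∈ with b ∈? tests j | same j
  ... | yes b∈ | _    = b∈
  ... | no  _  | a~b = contradiction (trans (sym a~b) (dec-true (a ∈? tests j) a∈)) λ ()

  DistinctSignatures : List A → Set
  DistinctSignatures = AllPairs λ a b → ¬ SameSignature a b

  collision-or-distinct : ∀ L → Unique L → Twins SameSignature L ⊎ DistinctSignatures L
  collision-or-distinct []      _           = inj₂ []
  collision-or-distinct (a ∷ L) (a∉L ∷ L!) with any? (sameSignature? a) L
  ... | yes twin = let b , b∈ , same = find twin in
    inj₁ (record { fst∈ = here refl ; snd∈ = there b∈ ; distinct = All.lookup a∉L b∈ ; related = same })
  ... | no ¬twin with collision-or-distinct L L!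
  ...   | inj₁ c = inj₁ (record { fst∈ = there fst∈ ; snd∈ = there snd∈ ; distinct = distinct ; related = related })
    where open Twins c
  ...   | inj₂ d = inj₂ (¬Any⇒All¬ L ¬twin ∷ d)

  hit : Fin k → A → ℕ
  hit j a = if signature a j then 1 else 0

  weight : A → ℕ
  weight a = ∑ λ j → hit j a

  hitCount : Fin k → List A → ℕ
  hitCount j L = length (filter (_∈? tests j) L)

  sum-weight : ∀ L → sum (map weight L) ≡ ∑ λ j → hitCount j L
  sum-weight []      = sym (sum-replicate-zero k)
    where open import Algebra.Properties.CommutativeMonoid.Sum +-0-commutativeMonoid using (sum-replicate-zero)
  sum-weight (a ∷ L) = begin
    weight a + sum (map weight L)                   ≡⟨ cong (weight a +_) (sum-weight L) ⟩
    weight a + ∑ (λ j → hitCount j L)               ≡⟨ sym (∑-distrib-+ (λ j → hit j a) _) ⟩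
    ∑ (λ j → hit j a + hitCount j L)                ≡⟨ sum-cong-≗ (λ j → sym (length-filter-∷ (_∈? tests j) a L)) ⟩
    ∑ (λ j → hitCount j (a ∷ L))                    ∎
    where open ≡-Reasoning

  hitCount≤ : ∀ {L} j → Unique L → hitCount j L ≤ length (tests j)
  hitCount≤ {L} j L! =
    unique-⊆⇒length≤ _≟_ (Unique.filter⁺ (_∈? tests j) L!) (proj₂ ∘ ∈-filter⁻ (_∈? tests j) {xs = L})

  weight≡0⇒signature≡false : ∀ {a} → weight a ≡ 0 → ∀ j → signature a j ≡ false
  weight≡0⇒signature≡false {a} w≡0 j with signature a j | ∑≡0⇒≡0 (λ j → hit j a) w≡0 j
  ... | false | _ = refl

  weight≡1⇒signature≡false : ∀ {a i j} → weight a ≡ 1 → signature a i ≡ true → i ≢ j → signature a j ≡ false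
  weight≡1⇒signature≡false {a} {i} {j} w≡1 hit-i i≢j
    with signature a i | signature a j | ∑-≤-pair (λ j → hit j a) i≢j
  ... | true | false | _ = refl
  ... | true | true  | 2≤1 = contradiction (≤-trans 2≤1 (≤-reflexive w≡1)) λ { (s≤s ()) }

  weight≡1⇒sameSignature : ∀ {a b j} → weight a ≡ 1 → weight b ≡ 1 →
    a ∈ tests j → b ∈ tests j → SameSignature a b
  weight≡1⇒sameSignature {a} {b} {j} wa wb a∈ b∈ i with j Fin.≟ i
  ... | yes refl = trans (dec-true (a ∈? tests j) a∈) (sym (dec-true (b ∈? tests j) b∈))
  ... | no j≢i = trans (weight≡1⇒signature≡false wa (dec-true (a ∈? tests j) a∈) j≢i)
                      (sym (weight≡1⇒signature≡false wb (dec-true (b ∈? tests j) b∈) j≢i))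

  zeros ones : List A → List A
  zeros = filter λ a → weight a ℕ.≟ 0
  ones  = filter λ a → weight a ℕ.≟ 1

  length-zeros : ∀ {L} → DistinctSignatures L → length (zeros L) ≤ 1
  length-zeros {L} distinct =
    AllPairs⇒length≤1 (AllPairs.filter⁺ (λ a → weight a ℕ.≟ 0) distinct)
      λ a∈ b∈ different → different λ j → trans (zero-signature a∈ j) (sym (zero-signature b∈ j))
    where
    zero-signature : ∀ {a} → a ∈ zeros L → ∀ j → signature a j ≡ false
    zero-signature a∈ = weight≡0⇒signature≡false (proj₂ (∈-filter⁻ (λ a → weight a ℕ.≟ 0) {xs = L} a∈))

  length-ones : ∀ {L} → DistinctSignatures L → length (ones L) ≤ k
  length-ones {L} distinct = begin
    length (ones L)                       ≡⟨ sym (sum-weight-ones (ones L) one) ⟩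
    sum (map weight (ones L))             ≡⟨ sum-weight (ones L) ⟩
    ∑ (λ j → hitCount j (ones L))         ≤⟨ ∑-≤-const _ hitCount≤1 ⟩
    k * 1                                 ≡⟨ *-identityʳ k ⟩
    k                                     ∎
    where
    open ≤-Reasoning
    one : ∀ {a} → a ∈ ones L → weight a ≡ 1
    one a∈ = proj₂ (∈-filter⁻ (λ a → weight a ℕ.≟ 1) {xs = L} a∈)
    sum-weight-ones : ∀ O → (∀ {a} → a ∈ O → weight a ≡ 1) → sum (map weight O) ≡ length O
    sum-weight-ones []      _   = refl
    sum-weight-ones (a ∷ O) one = cong₂ _+_ (one (here refl)) (sum-weight-ones O (one ∘ there))
    hitCount≤1 : ∀ j → hitCount j (ones L) ≤ 1
    hitCount≤1 j = AllPairs⇒length≤1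
      (AllPairs.filter⁺ (_∈? tests j) (AllPairs.filter⁺ (λ a → weight a ℕ.≟ 1) distinct))
      λ {a} {b} a∈ b∈ different →
        let a∈O , a∈j = ∈-filter⁻ (_∈? tests j) {xs = ones L} a∈
            b∈O , b∈j = ∈-filter⁻ (_∈? tests j) {xs = ones L} b∈
        in different (weight≡1⇒sameSignature (one a∈O) (one b∈O) a∈j b∈j)

  length+length≤ : ∀ L → length L + length L ≤ sum (map weight L) + length (ones L) + 2 * length (zeros L)
  length+length≤ []      = z≤n
  length+length≤ (a ∷ L) = begin
    suc (length L) + suc (length L)                      ≡⟨ +-suc (suc (length L)) (length L) ⟩
    2 + (length L + length L)                            ≤⟨ +-mono-≤ (2≤bonus (weight a)) (length+length≤ L) ⟩
    (w + o + 2 * z) + (sum (map weight L) + O + 2 * Z)   ≡⟨ regroup w o z (sum (map weight L)) O Z ⟩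
    (w + sum (map weight L)) + (o + O) + 2 * (z + Z)     ≡⟨ cong₂ (λ o′ z′ → w + sum (map weight L) + o′ + 2 * z′)
                                                             (sym (length-filter-∷ (λ a → weight a ℕ.≟ 1) a L))
                                                             (sym (length-filter-∷ (λ a → weight a ℕ.≟ 0) a L)) ⟩
    sum (map weight (a ∷ L)) + length (ones (a ∷ L)) + 2 * length (zeros (a ∷ L)) ∎
    where
    open ≤-Reasoning
    w = weight a
    o = if does (w ℕ.≟ 1) then 1 else 0
    z = if does (w ℕ.≟ 0) then 1 else 0
    O = length (ones L)
    Z = length (zeros L)
    2≤bonus : ∀ n → 2 ≤ n + (if does (n ℕ.≟ 1) then 1 else 0) + 2 * (if does (n ℕ.≟ 0) then 1 else 0)
    2≤bonus zero          = ≤-refl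
    2≤bonus (suc zero)    = ≤-refl
    2≤bonus (suc (suc n)) = s≤s (s≤s z≤n)
    regroup : ∀ w o z S O Z → (w + o + 2 * z) + (S + O + 2 * Z) ≡ (w + S) + (o + O) + 2 * (z + Z)
    regroup = solve-∀

  distinctSignatures⇒length≤ : ∀ {c} → (∀ j → length (tests j) ≤ c) → ∀ {L} → Unique L →
    DistinctSignatures L → length L + length L ≤ k * c + k + 2
  distinctSignatures⇒length≤ {c} small {L} L! distinct = begin
    length L + length L                                        ≤⟨ length+length≤ L ⟩
    sum (map weight L) + length (ones L) + 2 * length (zeros L) ≤⟨ +-mono-≤ (+-mono-≤ sum≤ (length-ones distinct))
                                                                             (*-monoʳ-≤ 2 (length-zeros distinct)) ⟩
    k * c + k + 2                                               ∎
    where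
    open ≤-Reasoning
    sum≤ : sum (map weight L) ≤ k * c
    sum≤ = ≤-trans (≤-reflexive (sum-weight L)) (∑-≤-const _ λ j → ≤-trans (hitCount≤ j L!) (small j))

  pigeonhole : ∀ {c} → (∀ j → length (tests j) ≤ c) → ∀ L → Unique L →
    k * c + k + 2 < length L + length L → Twins SameSignature L
  pigeonhole small L L! large with collision-or-distinct L L!
  ... | inj₁ twins    = twins
  ... | inj₂ distinct = contradiction (distinctSignatures⇒length≤ small L! distinct) (<⇒≱ large)

module _ {V : Set} {E : V → V → Set} where

  snoc : ∀ {u w z d} → Walk E u w d → E w z → Walk E u z (suc d)
  snoc here       e′ = step e′ here
  snoc (step e W) e′ = step e (snoc W e′)

  reverse : (∀ {a b} → E a b → E b a) → ∀ {u w d} → Walk E u w d → Walk E w u d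
  reverse E-sym here       = here
  reverse E-sym (step e W) = snoc (reverse E-sym W) (E-sym e)

  IsDist-sym : (∀ {a b} → E a b → E b a) → ∀ {u w d} → IsDist E u w d → IsDist E w u d
  IsDist-sym E-sym (W , shortest) = reverse E-sym W , λ d′ d′<d W′ → shortest d′ d′<d (reverse E-sym W′)

module Evasion {V : Set} (E : V → V → Set) {k : ℕ} (σ : Strategy V k) where

  detour : (ℕ → V) → ℕ → (ℕ → V) → ℕ → V
  detour w m       f zero    = w zero
  detour w zero    f (suc i) = f i
  detour w (suc m) f (suc i) = detour (w ∘ suc) m f i

  detour-≤ : ∀ w m f {i} → i ≤ m → detour w m f i ≡ w i
  detour-≤ w m       f {zero}  _         = refl
  detour-≤ w (suc m) f {suc i} (s≤s i≤m) = detour-≤ (w ∘ suc) m f i≤m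

  detour-> : ∀ w m f d → detour w m f (suc (d + m)) ≡ f d
  detour-> w zero    f d rewrite +-identityʳ d = refl
  detour-> w (suc m) f d rewrite +-suc d m = detour-> (w ∘ suc) m f d

  detour-walk : ∀ {w m f} → RobberWalk E w → RobberWalk E f → E (w m) (f 0) → RobberWalk E (detour w m f)
  detour-walk {m = zero}  _    _    e zero    = inj₂ e
  detour-walk {m = zero}  _    f-ok _ (suc i) = f-ok i
  detour-walk {m = suc m} w-ok _    _ zero    = w-ok zero
  detour-walk {m = suc m} w-ok f-ok e (suc i) = detour-walk (w-ok ∘ suc) f-ok e i

  history-suc : (rs : ℕ → Fin k → ℕ) → ∀ i → history rs (suc i) ≡ history rs i ∷ʳ rs i
  history-suc rs i = begin
    map rs (upTo (suc i))       ≡⟨ cong (map rs) (sym (upTo-∷ʳ i)) ⟩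
    map rs (upTo i ∷ʳ i)        ≡⟨ map-++ rs (upTo i) (i ∷ []) ⟩
    history rs i ∷ʳ rs i        ∎
    where
    open ≡-Reasoning
    open import Data.List.Properties using (upTo-∷ʳ; map-++)

  AnswersUpTo-cong : ∀ {w w′ rs t} → (∀ {i} → i ≤ t → w′ i ≡ w i) →
    AnswersUpTo E σ w rs t → AnswersUpTo E σ w′ rs t
  AnswersUpTo-cong {rs = rs} w′≡w answers i i≤t j =
    subst (λ u → IsDist E (σ (history rs i) j) u (rs i j)) (sym (w′≡w i≤t)) (answers i i≤t j)

  AnswersUpTo-suc : ∀ {w rs t} → AnswersUpTo E σ w rs t →
    (∀ j → IsDist E (σ (history rs (suc t)) j) (w (suc t)) (rs (suc t) j)) → AnswersUpTo E σ w rs (suc t)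
  AnswersUpTo-suc answers last i i≤1+t with m≤n⇒m<n∨m≡n i≤1+t
  ... | inj₁ (s≤s i≤t) = answers i i≤t
  ... | inj₂ refl      = last

  answeredAs : ∀ (w : ℕ → V) (rs : ℕ → Fin k → ℕ) {i h u a} → history rs i ≡ h → w i ≡ u → rs i ≡ a →
    (∀ j → IsDist E (σ h j) u (a j)) → ∀ j → IsDist E (σ (history rs i) j) (w i) (rs i j)
  answeredAs _ _ refl refl refl answered = answered

  movesTo : ∀ {u u′ u″} → u ≡ u′ → E u′ u″ → E u u″
  movesTo refl e = e

  movesAs : ∀ (w : ℕ → V) i {u u′} → w i ≡ u → w (suc i) ≡ u′ → E u u′ → w (suc i) ≡ w i ⊎ E (w i) (w (suc i))
  movesAs _ _ refl refl e = inj₂ e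

  Ambiguous : (ℕ → V) → (ℕ → Fin k → ℕ) → ℕ → Set
  Ambiguous w rs t = Σ (ℕ → V) λ w′ → RobberWalk E w′ × AnswersUpTo E σ w′ rs t × w′ t ≢ w t

  alwaysAmbiguous⇒¬Wins : ∀ {w rs} → RobberWalk E w → (∀ t → AnswersUpTo E σ w rs t) →
    (∀ t → Ambiguous w rs t) → ¬ Wins E σ
  alwaysAmbiguous⇒¬Wins w-ok honest ambiguous wins with wins _ w-ok _ honest
  ... | t , located with ambiguous t
  ...   | w′ , w′-ok , w′-answers , w′t≢wt = w′t≢wt (located w′ w′-ok w′-answers)

-- Unlike 2 * n, twice (suc n) reduces to suc (suc (twice n)).
twice : ℕ → ℕ
twice zero    = zero
twice (suc n) = suc (suc (twice n))

data Parity : ℕ → Set where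
  even : ∀ n → Parity (twice n)
  odd  : ∀ n → Parity (suc (twice n))

parity : ∀ i → Parity i
parity zero = even zero
parity (suc i) with parity i
... | even n = odd n
... | odd  n = even (suc n)

interleave : {A : Set} → (ℕ → A) → (ℕ → A) → ℕ → A
interleave f g zero          = f zero
interleave f g (suc zero)    = g zero
interleave f g (suc (suc i)) = interleave (f ∘ suc) (g ∘ suc) i

interleave-even : ∀ {A : Set} (f g : ℕ → A) n → interleave f g (twice n) ≡ f n
interleave-even f g zero    = refl
interleave-even f g (suc n) = interleave-even (f ∘ suc) (g ∘ suc) n

interleave-odd : ∀ {A : Set} (f g : ℕ → A) n → interleave f g (suc (twice n)) ≡ g n
interleave-odd f g zero    = refl
interleave-odd f g (suc n) = interleave-odd (f ∘ suc) (g ∘ suc) n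

module IncidenceGraph {v : ℕ} (S : STS v) where

  open import Data.Fin.Subset.Properties using () renaming (_∈?_ to _∈ˢ?_)
  open import Relation.Nullary.Decidable using (_×-dec_)

  Point Line : Set
  Point = Fin v
  Line  = Fin (b S)

  _on_ : Point → Line → Set
  x on B = x ∈ˢ block S B

  _on?_ : ∀ x B → Dec (x on B)
  x on? B = x ∈ˢ? block S B

  points : Line → List Point
  points B = elements (block S B)

  length-points : ∀ B → length (points B) ≡ 3
  length-points B = trans (length-elements (block S B)) (block-size S B)

  somePoint : ∀ B → Σ Point (_on B)
  somePoint B with nonempty⇒∈ (points B) (≤-trans (s≤s z≤n) (≤-reflexive (sym (length-points B))))
  ... | x , x∈B = x , ∈-elements⁻ x∈B

  line : (x y : Point) → x ≢ y → Line
  line x y x≢y = proj₁ (pair-ex S x y x≢y)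

  on-line₁ : ∀ x y x≢y → x on line x y x≢y
  on-line₁ x y x≢y = proj₁ (proj₂ (pair-ex S x y x≢y))

  on-line₂ : ∀ x y x≢y → y on line x y x≢y
  on-line₂ x y x≢y = proj₂ (proj₂ (pair-ex S x y x≢y))

  line-unique : ∀ {x y B} (x≢y : x ≢ y) → x on B → y on B → B ≡ line x y x≢y
  line-unique {x} {y} {B} x≢y x∈B y∈B =
    pair-uniq S x y x≢y B (line x y x≢y) x∈B y∈B (on-line₁ x y x≢y) (on-line₂ x y x≢y)

  others : Point → Line → List Point
  others x B = remove Fin._≟_ x (points B)

  length-others : ∀ {x B} → x on B → length (others x B) ≤ 2
  length-others {x} {B} x∈B =
    ≤-pred (≤-trans (length-remove< Fin._≟_ (∈-elements⁺ x∈B)) (≤-reflexive (length-points B)))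

  ∈-others : ∀ {x y B} → y on B → y ≢ x → y ∈ others x B
  ∈-others y∈B = ∈-remove⁺ Fin._≟_ (∈-elements⁺ y∈B)

  Meet : Line → Line → Set
  Meet B C = Σ Point λ y → y on B × y on C

  meet? : ∀ B C → Dec (Meet B C)
  meet? B C = Fin.any? λ y → (y on? B) ×-dec (y on? C)

  Vertex : Set
  Vertex = IncV S

  _~_ : Vertex → Vertex → Set
  _~_ = IncE S

  ~-sym : ∀ {u w} → u ~ w → w ~ u
  ~-sym {inj₁ _} {inj₂ _} e = e
  ~-sym {inj₂ _} {inj₁ _} e = e

  dist : Vertex → Vertex → ℕ
  dist (inj₁ x) (inj₁ y) = if does (x Fin.≟ y) then 0 else 2
  dist (inj₁ x) (inj₂ B) = if does (x on? B) then 1 else 3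
  dist (inj₂ B) (inj₁ x) = dist (inj₁ x) (inj₂ B)
  dist (inj₂ B) (inj₂ C) = if does (B Fin.≟ C) then 0 else if does (meet? B C) then 2 else 4

  viaLine : ∀ {x y} B → x on B → y on B → Walk _~_ (inj₁ x) (inj₁ y) 2
  viaLine B x∈B y∈B = step {x = inj₂ B} x∈B (step y∈B here)

  viaPoint : ∀ {B C} y → y on B → y on C → Walk _~_ (inj₂ B) (inj₂ C) 2
  viaPoint y y∈B y∈C = step {x = inj₁ y} y∈B (step y∈C here)

  isDist-point-point : ∀ x y → IsDist _~_ (inj₁ x) (inj₁ y) (dist (inj₁ x) (inj₁ y))
  isDist-point-point x y with x Fin.≟ y
  ... | yes refl = here , λ _ ()
  ... | no x≢y   = viaLine (line x y x≢y) (on-line₁ x y x≢y) (on-line₂ x y x≢y) , shorter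
    where
    shorter : ∀ d → d < 2 → ¬ Walk _~_ (inj₁ x) (inj₁ y) d
    shorter zero       _ here                     = x≢y refl
    shorter (suc zero) _ (step {x = inj₂ _} _ ())
    shorter (suc (suc _)) (s≤s (s≤s ())) _

  isDist-point-line : ∀ x B → IsDist _~_ (inj₁ x) (inj₂ B) (dist (inj₁ x) (inj₂ B))
  isDist-point-line x B with x on? B
  ... | yes x∈B = step x∈B here , λ { zero _ () ; (suc _) (s≤s ()) _ }
  ... | no  x∉B with somePoint B
  ...   | y , y∈B = snoc (viaLine (line x y x≢y) (on-line₁ x y x≢y) (on-line₂ x y x≢y)) y∈B , shorter
    where
    x≢y : x ≢ y
    x≢y refl = x∉B y∈B
    shorter : ∀ d → d < 3 → ¬ Walk _~_ (inj₁ x) (inj₂ B) d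
    shorter (suc zero)       _ (step {x = inj₂ _} x∈B here)      = x∉B x∈B
    shorter (suc (suc zero)) _ (step {x = inj₂ _} _ (step () here))
    shorter (suc (suc (suc _))) (s≤s (s≤s (s≤s ()))) _

  isDist-line-line : ∀ B C → IsDist _~_ (inj₂ B) (inj₂ C) (dist (inj₂ B) (inj₂ C))
  isDist-line-line B C with B Fin.≟ C
  ... | yes refl = here , λ _ ()
  ... | no B≢C with meet? B C
  ...   | yes (y , y∈B , y∈C) = viaPoint y y∈B y∈C , shorter
    where
    shorter : ∀ d → d < 2 → ¬ Walk _~_ (inj₂ B) (inj₂ C) d
    shorter zero       _ here                     = B≢C refl
    shorter (suc zero) _ (step {x = inj₁ _} _ ())
    shorter (suc (suc _)) (s≤s (s≤s ())) _
  ...   | no ¬meet with somePoint B | somePoint C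
  ...     | y , y∈B | z , z∈C =
    step {x = inj₁ y} y∈B (snoc (viaLine (line y z y≢z) (on-line₁ y z y≢z) (on-line₂ y z y≢z)) z∈C) , shorter
    where
    y≢z : y ≢ z
    y≢z refl = ¬meet (y , y∈B , z∈C)
    shorter : ∀ d → d < 4 → ¬ Walk _~_ (inj₂ B) (inj₂ C) d
    shorter zero                   _ here                                            = B≢C refl
    shorter (suc zero)             _ (step {x = inj₁ _} _ ())
    shorter (suc (suc zero))       _ (step {x = inj₁ y} y∈B (step y∈C here))         = ¬meet (y , y∈B , y∈C)
    shorter (suc (suc (suc zero))) _ (step {x = inj₁ _} _ (step {x = inj₂ _} _ (step () here)))
    shorter (suc (suc (suc (suc _)))) (s≤s (s≤s (s≤s (s≤s ())))) _

  isDist : ∀ u w → IsDist _~_ u w (dist u w)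
  isDist (inj₁ x) (inj₁ y) = isDist-point-point x y
  isDist (inj₁ x) (inj₂ B) = isDist-point-line x B
  isDist (inj₂ B) (inj₁ x) = IsDist-sym ~-sym (isDist-point-line x B)
  isDist (inj₂ B) (inj₂ C) = isDist-line-line B C

  near : Vertex → List Point
  near (inj₁ p) = p ∷ []
  near (inj₂ C) = points C

  length-near : ∀ q → length (near q) ≤ 3
  length-near (inj₁ p) = s≤s z≤n
  length-near (inj₂ C) = ≤-reflexive (length-points C)

  dist-point-cong : ∀ q {s s′} → (s ∈ near q → s′ ∈ near q) → (s′ ∈ near q → s ∈ near q) →
    dist q (inj₁ s) ≡ dist q (inj₁ s′)
  dist-point-cong (inj₁ p) {s} {s′} ⇒ ⇐ with p Fin.≟ s | p Fin.≟ s′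
  ... | yes _    | yes _    = refl
  ... | no  _    | no  _    = refl
  ... | yes refl | no  p≢s′ = contradiction (singleton (⇒ (here refl))) p≢s′
    where singleton : ∀ {a b : Point} → a ∈ b ∷ [] → b ≡ a
          singleton (here a≡b) = sym a≡b
  ... | no  p≢s  | yes refl = contradiction (singleton (⇐ (here refl))) p≢s
    where singleton : ∀ {a b : Point} → a ∈ b ∷ [] → b ≡ a
          singleton (here a≡b) = sym a≡b
  dist-point-cong (inj₂ C) {s} {s′} ⇒ ⇐ with s on? C | s′ on? C
  ... | yes _   | yes _    = refl
  ... | no  _   | no  _    = refl
  ... | yes s∈C | no  s′∉C = contradiction (∈-elements⁻ (⇒ (∈-elements⁺ s∈C))) s′∉C
  ... | no  s∉C | yes s′∈C = contradiction (∈-elements⁻ (⇐ (∈-elements⁺ s′∈C))) s∉C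

  SameDistances : ∀ {k} → (Fin k → Vertex) → Point → Point → Set
  SameDistances P s s′ = ∀ j → dist (P j) (inj₁ s) ≡ dist (P j) (inj₁ s′)

  twins : ∀ {k} (P : Fin k → Vertex) L → Unique L → suc (k + k) < length L → Twins (SameDistances P) L
  twins {k} P L L! large =
    Twins-map (λ same j → dist-point-cong (P j) (sameSignature⇒∈ same j) (sameSignature⇒∈ (sym ∘ same) j))
              (pigeonhole (length-near ∘ P) L L! (≤-trans (bound k) (+-mono-≤ large large)))
    where
    open Signatures Fin._≟_ (near ∘ P)
    bound : ∀ k → suc (k * 3 + k + 2) ≤ suc (suc (k + k)) + suc (suc (k + k))
    bound k = ≤-trans (n≤1+n _) (≤-reflexive (regroup k))
      where
      regroup : ∀ k → suc (suc (k * 3 + k + 2)) ≡ suc (suc (k + k)) + suc (suc (k + k))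
      regroup = solve-∀

  -- A line through x lies at distance typical x q from the probe q unless it contains q's
  -- point (other than x), or equals or meets q's line outside x; there are at most three
  -- such lines, and atypical x q lists their points other than x.
  typical : Point → Vertex → ℕ
  typical x (inj₁ p) = if does (p Fin.≟ x) then 1 else 3
  typical x (inj₂ C) = if does (x on? C) then 2 else 4

  atypical : Point → Vertex → List Point
  atypical x (inj₁ p) with p Fin.≟ x
  ... | yes _   = []
  ... | no  p≢x = others x (line x p (p≢x ∘ sym))
  atypical x (inj₂ C) with x on? C
  ... | yes _ = others x C
  ... | no  _ = concatMap (atypical x ∘ inj₁) (points C)

  length-atypical-point : ∀ x p → length (atypical x (inj₁ p)) ≤ 2
  length-atypical-point x p with p Fin.≟ x
  ... | yes _   = z≤n
  ... | no  p≢x = length-others (on-line₁ x p (p≢x ∘ sym))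

  length-atypical : ∀ x q → length (atypical x q) ≤ 6
  length-atypical x (inj₁ p) = ≤-trans (length-atypical-point x p) (s≤s (s≤s z≤n))
  length-atypical x (inj₂ C) with x on? C
  ... | yes x∈C = ≤-trans (length-others x∈C) (s≤s (s≤s z≤n))
  ... | no  _   = ≤-trans (length-concatMap≤ (length-atypical-point x) (points C))
                          (≤-reflexive (cong (_* 2) (length-points C)))

  others-line : ∀ {x p u B} (x≢p : x ≢ p) → x on B → p on B → u on B → u ≢ x → u ∈ others x (line x p x≢p)
  others-line x≢p x∈B p∈B u∈B u≢x = subst (λ L → _ ∈ others _ L) (line-unique x≢p x∈B p∈B) (∈-others u∈B u≢x)

  ∈-atypical-point : ∀ {x p u B} → p ≢ x → x on B → p on B → u on B → u ≢ x → u ∈ atypical x (inj₁ p)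
  ∈-atypical-point {x} {p} p≢x x∈B p∈B u∈B u≢x with p Fin.≟ x
  ... | yes p≡x  = contradiction p≡x p≢x
  ... | no  p≢x′ = others-line (p≢x′ ∘ sym) x∈B p∈B u∈B u≢x

  typical-dist : ∀ {x u B} q → u ≢ x → u ∉ atypical x q → x on B → u on B → dist q (inj₂ B) ≡ typical x q
  typical-dist {x} {u} {B} (inj₁ p) u≢x u∉ x∈B u∈B with p Fin.≟ x
  ... | yes refl = ifᵈ-yes (p on? B) x∈B
  ... | no  p≢x  = ifᵈ-no (p on? B) λ p∈B → u∉ (others-line (p≢x ∘ sym) x∈B p∈B u∈B u≢x)
  typical-dist {x} {u} {B} (inj₂ C) u≢x u∉ x∈B u∈B with x on? C
  ... | yes x∈C = trans (ifᵈ-no (C Fin.≟ B) C≢B) (ifᵈ-yes (meet? C B) (x , x∈C , x∈B))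
    where
    C≢B : C ≢ B
    C≢B refl = u∉ (∈-others u∈B u≢x)
  ... | no  x∉C = trans (ifᵈ-no (C Fin.≟ B) C≢B) (ifᵈ-no (meet? C B) ¬meet)
    where
    C≢B : C ≢ B
    C≢B refl = x∉C x∈B
    ¬meet : ¬ Meet C B
    ¬meet (c , c∈C , c∈B) = u∉ (∈-concatMap⁺ (∈-elements⁺ c∈C) (∈-atypical-point c≢x x∈B c∈B u∈B u≢x))
      where
      c≢x : c ≢ x
      c≢x refl = x∉C c∈C

  module Ordinary (x : Point) {k : ℕ} (P : Fin k → Vertex) where

    open import Data.List.Membership.DecPropositional (Fin._≟_ {v}) using (_∈?_; _∉?_)

    exceptional : List Point
    exceptional = x ∷ concatMap (atypical x ∘ P) (allFin k)

    ordinary : List Point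
    ordinary = filter (_∉? exceptional) (allFin v)

    TypicalLine : Line → Set
    TypicalLine B = x on B × ∀ j → dist (P j) (inj₂ B) ≡ typical x (P j)

    length-ordinary : v ≤ length ordinary + suc (k * 6)
    length-ordinary = begin
      v                                     ≡⟨ sym (length-tabulate {n = v} (λ u → u)) ⟩
      length (allFin v)                     ≤⟨ unique-⊆⇒length≤ Fin._≟_ (Unique.allFin⁺ v) split ⟩
      length (ordinary ++ exceptional)      ≡⟨ length-++ ordinary ⟩
      length ordinary + length exceptional  ≤⟨ +-monoʳ-≤ (length ordinary) (s≤s length-atypicals) ⟩
      length ordinary + suc (k * 6)         ∎
      where
      open ≤-Reasoning
      split : allFin v ⊆ ordinary ++ exceptional
      split {u} u∈ with u ∈? exceptional
      ... | yes u∈exc = ∈-++⁺ʳ ordinary u∈exc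
      ... | no  u∉exc = ∈-++⁺ˡ (∈-filter⁺ (_∉? exceptional) u∈ u∉exc)
      length-atypicals : length (concatMap (atypical x ∘ P) (allFin k)) ≤ k * 6
      length-atypicals = ≤-trans (length-concatMap≤ (length-atypical x ∘ P) (allFin k))
                                 (≤-reflexive (cong (_* 6) (length-tabulate {n = k} (λ j → j))))

    ordinary⇒≢ : ∀ {u} → u ∈ ordinary → x ≢ u
    ordinary⇒≢ u∈ x≡u = proj₂ (∈-filter⁻ (_∉? exceptional) {xs = allFin v} u∈) (here (sym x≡u))

    ordinary⇒typical : ∀ {u} (u∈ : u ∈ ordinary) → TypicalLine (line x u (ordinary⇒≢ u∈))
    ordinary⇒typical {u} u∈ = on-line₁ x u x≢u , λ j →
      typical-dist (P j) (x≢u ∘ sym) (λ u∈atyp → u∉exc (there (∈-concatMap⁺ (∈-allFin j) u∈atyp)))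
                   (on-line₁ x u x≢u) (on-line₂ x u x≢u)
      where
      x≢u = ordinary⇒≢ u∈
      u∉exc = proj₂ (∈-filter⁻ (_∉? exceptional) {xs = allFin v} u∈)

    x∷ordinary-unique : Unique (x ∷ ordinary)
    x∷ordinary-unique = All.tabulate ordinary⇒≢ ∷ Unique.filter⁺ (_∉? exceptional) (Unique.allFin⁺ v)

    typicalLineThrough : 0 < length ordinary → ∀ {s} → s ∈ x ∷ ordinary → Σ Line λ B → TypicalLine B × s on B
    typicalLineThrough nonempty (here refl) with nonempty⇒∈ ordinary nonempty
    ... | u , u∈ = _ , ordinary⇒typical u∈ , on-line₁ x u (ordinary⇒≢ u∈)
    typicalLineThrough _ {s} (there s∈) = _ , ordinary⇒typical s∈ , on-line₂ x s (ordinary⇒≢ s∈)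

    anotherTypicalLine : 3 ≤ length ordinary → ∀ B₀ → x on B₀ → Σ Line λ B → B ≢ B₀ × TypicalLine B
    anotherTypicalLine 3≤ B₀ x∈B₀ with all? (_on? B₀) ordinary
    ... | yes all-on = contradiction (unique-⊆⇒length≤ Fin._≟_ x∷ordinary-unique on-B₀) λ 4≤3 →
                         <⇒≱ (s≤s 3≤) (≤-trans 4≤3 (≤-reflexive (length-points B₀)))
      where
      on-B₀ : x ∷ ordinary ⊆ points B₀
      on-B₀ (here refl) = ∈-elements⁺ x∈B₀
      on-B₀ (there u∈)  = ∈-elements⁺ (All.lookup all-on u∈)
    ... | no ¬all-on with find (¬All⇒Any¬ (_on? B₀) ordinary ¬all-on)
    ...   | u , u∈ , u∉B₀ = _ , (λ B≡B₀ → u∉B₀ (subst (u on_) B≡B₀ (on-line₂ x u (ordinary⇒≢ u∈))))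
                              , ordinary⇒typical u∈

module Robber {v : ℕ} (S : STS v) {k : ℕ} (σ : Strategy (IncV S) k)
              (enough : 8 * k + 2 ≤ v) (large : 10 ≤ v) where

  open IncidenceGraph S
  open Evasion _~_ σ

  Hist : Set
  Hist = List (Fin k → ℕ)

  answers : Hist → Vertex → Fin k → ℕ
  answers h u j = dist (σ h j) u

  afterPoint : Point → Hist → Hist
  afterPoint x h = h ∷ʳ answers h (inj₁ x)

  typicalAnswers : Point → Hist → Fin k → ℕ
  typicalAnswers x h j = typical x (σ (afterPoint x h) j)

  afterLine : Point → Hist → Hist
  afterLine x h = afterPoint x h ∷ʳ typicalAnswers x h

  Typical : Point → Hist → Line → Set
  Typical x h = Ordinary.TypicalLine x (σ (afterPoint x h))

  -- Three rounds of the robber's walk: at x (history h), on line₁, at next.  A robber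
  -- on line′ instead of line₁, or on line₂ and then at twin, receives the same answers.
  record Stage (x : Point) (h : Hist) : Set where
    field
      next twin         : Point
      line₁ line₂ line′ : Line
      typical₁          : Typical x h line₁
      typical₂          : Typical x h line₂
      typical′          : Typical x h line′
      next-on           : next on line₁
      twin-on           : twin on line₂
      next≢twin         : next ≢ twin
      line′≢line₁       : line′ ≢ line₁
      twin-answers      : SameDistances (σ (afterLine x h)) next twin

  module _ (x : Point) (P : Fin k → Vertex) where
    open Ordinary x P

    many-ordinary : suc (k + k) ≤ length ordinary
    many-ordinary = +-cancelʳ-≤ (suc (k * 6)) (suc (k + k)) (length ordinary)
      (≤-trans (≤-reflexive (regroup k)) (≤-trans enough length-ordinary))
      where
      regroup : ∀ k → suc (k + k) + suc (k * 6) ≡ 8 * k + 2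
      regroup = solve-∀

    three-ordinary : 3 ≤ length ordinary
    three-ordinary = +-cancelʳ-≤ (suc (k * 6)) 3 (length ordinary) (≤-trans (6k+4≤v k enough) length-ordinary)
      where
      6k+4≤v : ∀ k → 8 * k + 2 ≤ v → 3 + suc (k * 6) ≤ v
      6k+4≤v zero    _      = ≤-trans (s≤s (s≤s (s≤s (s≤s z≤n)))) large
      6k+4≤v (suc k) 8k+2≤v = ≤-trans (m≤m+n _ (k + k)) (≤-trans (≤-reflexive (regroup k)) 8k+2≤v)
        where
        regroup : ∀ k → 3 + suc (suc k * 6) + (k + k) ≡ 8 * suc k + 2
        regroup = solve-∀

  -- Opaque: otherwise the type checker unfolds this construction whenever stages are compared.
  opaque
    stage : ∀ x h → Stage x h
    stage x h = record
      { next = fst ; twin = snd ; line₁ = proj₁ through₁ ; line₂ = proj₁ through₂ ; line′ = proj₁ other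
      ; typical₁ = proj₁ (proj₂ through₁) ; typical₂ = proj₁ (proj₂ through₂) ; typical′ = proj₂ (proj₂ other)
      ; next-on = proj₂ (proj₂ through₁) ; twin-on = proj₂ (proj₂ through₂)
      ; next≢twin = distinct ; line′≢line₁ = proj₁ (proj₂ other) ; twin-answers = related }
      where
      P : Fin k → Vertex
      P = σ (afterPoint x h)
      open Ordinary x P
      open Twins (twins (σ (afterLine x h)) (x ∷ ordinary) x∷ordinary-unique (s≤s (many-ordinary x P)))
      nonempty : 0 < length ordinary
      nonempty = ≤-trans (s≤s z≤n) (three-ordinary x P)
      through₁ : Σ Line λ B → TypicalLine B × fst on B
      through₁ = typicalLineThrough nonempty fst∈
      through₂ : Σ Line λ B → TypicalLine B × snd on B
      through₂ = typicalLineThrough nonempty snd∈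
      other : Σ Line λ B → B ≢ proj₁ through₁ × TypicalLine B
      other = anotherTypicalLine (three-ordinary x P) (proj₁ through₁) (proj₁ (proj₁ (proj₂ through₁)))

  opening : Twins (SameDistances (σ [])) (allFin v)
  opening = twins (σ []) (allFin v) (Unique.allFin⁺ v)
    (≤-trans (m≤m+n _ (6 * k)) (≤-trans (≤-reflexive (regroup k))
      (≤-trans enough (≤-reflexive (sym (length-tabulate {n = v} (λ u → u)))))))
    where
    regroup : ∀ k → suc (suc (k + k)) + 6 * k ≡ 8 * k + 2
    regroup = solve-∀

  advance : Point × Hist → Point × Hist
  advance (x , h) = Stage.next (stage x h) , afterLine x h

  start : ℕ → Point × Hist
  start zero    = Twins.fst opening , []
  start (suc n) = advance (start n)

  pointAt : ℕ → Point
  pointAt n = proj₁ (start n)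

  histAt : ℕ → Hist
  histAt n = proj₂ (start n)

  stageAt : ∀ n → Stage (pointAt n) (histAt n)
  stageAt n = stage (pointAt n) (histAt n)

  robber : ℕ → Vertex
  robber = interleave (λ n → inj₁ (pointAt n)) (λ n → inj₂ (Stage.line₁ (stageAt n)))

  replies : ℕ → Fin k → ℕ
  replies = interleave (λ n → answers (histAt n) (inj₁ (pointAt n))) (λ n → typicalAnswers (pointAt n) (histAt n))

  robber-even : ∀ n → robber (twice n) ≡ inj₁ (pointAt n)
  robber-even = interleave-even _ _

  robber-odd : ∀ n → robber (suc (twice n)) ≡ inj₂ (Stage.line₁ (stageAt n))
  robber-odd = interleave-odd _ _

  replies-even : ∀ n → replies (twice n) ≡ answers (histAt n) (inj₁ (pointAt n))
  replies-even = interleave-even _ _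

  replies-odd : ∀ n → replies (suc (twice n)) ≡ typicalAnswers (pointAt n) (histAt n)
  replies-odd = interleave-odd _ _

  history-even : ∀ n → history replies (twice n) ≡ histAt n
  history-odd  : ∀ n → history replies (suc (twice n)) ≡ afterPoint (pointAt n) (histAt n)
  history-even zero    = refl
  history-even (suc n) = trans (history-suc replies (suc (twice n))) (cong₂ _∷ʳ_ (history-odd n) (replies-odd n))
  history-odd  n       = trans (history-suc replies (twice n)) (cong₂ _∷ʳ_ (history-even n) (replies-even n))

  honest : ∀ i j → IsDist _~_ (σ (history replies i) j) (robber i) (replies i j)
  honest i with parity i
  ... | even n = answeredAs robber replies (history-even n) (robber-even n) (replies-even n) λ j → isDist _ _
  ... | odd  n = answeredAs robber replies (history-odd n) (robber-odd n) (replies-odd n) λ j →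
    subst (IsDist _~_ _ _) (proj₂ (Stage.typical₁ (stageAt n)) j) (isDist _ _)

  robber-walk : RobberWalk _~_ robber
  robber-walk i with parity i
  ... | even n = movesAs robber (twice n) (robber-even n) (robber-odd n) (proj₁ (Stage.typical₁ (stageAt n)))
  ... | odd  n = movesAs robber (suc (twice n)) (robber-odd n) (robber-even (suc n)) (Stage.next-on (stageAt n))

  ambiguous-opening : Ambiguous robber replies 0
  ambiguous-opening = (λ _ → inj₁ snd) , (λ _ → inj₁ refl) , answered
                    , λ twin≡start → distinct (sym (inj₁-injective twin≡start))
    where
    open Twins opening
    answered : AnswersUpTo _~_ σ (λ _ → inj₁ snd) replies 0
    answered zero z≤n j = subst (IsDist _~_ (σ [] j) (inj₁ snd)) (sym (related j)) (isDist _ _)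

  ambiguous-line : ∀ n → Ambiguous robber replies (suc (twice n))
  ambiguous-line n = w′ , detour-walk robber-walk (λ _ → inj₁ refl) (movesTo (robber-even n) (proj₁ typical′))
                   , AnswersUpTo-suc (AnswersUpTo-cong (detour-≤ robber m f) (λ i _ → honest i))
                       (answeredAs w′ replies (history-odd n) (detour-> robber m f 0) (replies-odd n) λ j →
                          subst (IsDist _~_ _ _) (proj₂ typical′ j) (isDist _ _))
                   , λ line′≡line₁ → line′≢line₁ (inj₂-injective (trans (sym (detour-> robber m f 0))
                                                                  (trans line′≡line₁ (robber-odd n))))
    where
    open Stage (stageAt n)
    m = twice n
    f : ℕ → Vertex
    f _ = inj₂ line′
    w′ = detour robber m f

  ambiguous-point : ∀ n → Ambiguous robber replies (twice (suc n))
  ambiguous-point n = w′ , detour-walk robber-walk f-walk (movesTo (robber-even n) (proj₁ typical₂))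
                    , AnswersUpTo-suc (AnswersUpTo-suc (AnswersUpTo-cong (detour-≤ robber m f) (λ i _ → honest i))
                        (answeredAs w′ replies (history-odd n) (detour-> robber m f 0) (replies-odd n) λ j →
                           subst (IsDist _~_ _ _) (proj₂ typical₂ j) (isDist _ _)))
                        (answeredAs w′ replies (history-even (suc n)) (detour-> robber m f 1) (replies-even (suc n)) λ j →
                           subst (IsDist _~_ _ _) (sym (twin-answers j)) (isDist _ _))
                    , λ twin≡next → next≢twin (sym (inj₁-injective (trans (sym (detour-> robber m f 1))
                                                                      (trans twin≡next (robber-even (suc n))))))
    where
    open Stage (stageAt n)
    m = twice n
    f : ℕ → Vertex
    f zero    = inj₂ line₂
    f (suc _) = inj₁ twin
    f-walk : RobberWalk _~_ f
    f-walk zero    = inj₂ twin-on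
    f-walk (suc _) = inj₁ refl
    w′ = detour robber m f

  ambiguous : ∀ t → Ambiguous robber replies t
  ambiguous t with parity t
  ... | even zero    = ambiguous-opening
  ... | even (suc n) = ambiguous-point n
  ... | odd  n       = ambiguous-line n

  robber-escapes : ¬ Wins _~_ σ
  robber-escapes = alwaysAmbiguous⇒¬Wins robber-walk (λ t i _ → honest i) ambiguous

k≤[v∸2]/8⇒8k+2≤v : ∀ {k v} → k ≤ (v ∸ 2) / 8 → 2 ≤ v → 8 * k + 2 ≤ v
k≤[v∸2]/8⇒8k+2≤v {k} {v} k≤ 2≤v = begin
  8 * k + 2               ≤⟨ +-monoˡ-≤ 2 (*-monoʳ-≤ 8 k≤) ⟩
  8 * ((v ∸ 2) / 8) + 2   ≡⟨ cong (_+ 2) (*-comm 8 ((v ∸ 2) / 8)) ⟩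
  (v ∸ 2) / 8 * 8 + 2     ≤⟨ +-monoˡ-≤ 2 (m/n*n≤m (v ∸ 2) 8) ⟩
  v ∸ 2 + 2               ≡⟨ m∸n+n≡m 2≤v ⟩
  v                       ∎
  where open ≤-Reasoning

corollary4p1 : (v : ℕ) → 9 < v → (S : STS v) →
    LocNumberGreaterThan (IncE S) ((v ∸ 2) / 8)
corollary4p1 v 9<v S k k≤ (σ , wins) =
  Robber.robber-escapes S σ (k≤[v∸2]/8⇒8k+2≤v k≤ (≤-trans (s≤s (s≤s z≤n)) 9<v)) 9<v wins
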